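{- Let $G$ be a finite simple graph and let $\lambda$ be an integer partition of $|V(G)|$. For every special rim hook tabloid $T$ of shape $\lambda$ with $N_G(T)>0$: (1) every part of $\pi(T)$ is at most the independence number $\alpha(G)$; (2) the number of parts of $\pi(T)$ is at most the number of parts of $\lambda$; (3) if every stable partition of $G$ contains a stable set consisting of a single vertex, then some part of $\pi(T)$ equals $1$.
   Context: A stable partition of $G$ is a set partition of $V(G)$ into stable (independent) sets; its type is the integer partition of block sizes. Young diagrams are in French notation (row $i$ from the bottom has $\lambda_i$ left-justified cells). A rim hook is a sequence of edge-connected cells along the northeast boundary of a Young diagram whose removal leaves the Young diagram of a smaller partition. A rim hook tabloid of shape $\lambda$ is a filling of the diagram of $\lambda$ by rim hooks that can be successively removed, each removal leaving the Young diagram of a partition; it is special if every rim hook intersects the first column. For such a tabloid $T$, $\pi(T)$ is the integer partition whose parts are the lengths of its rim hooks, and $N_G(T)$ is the number of stable partitions of $G$ of type $\pi(T)$. -}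

module Defs where

open import Data.Nat using (ℕ; zero; suc; _+_; _≤_; _<_; _≥_)
open import Data.Nat.Properties using ()
open import Data.Bool using (Bool; true; false)
open import Data.Fin using (Fin; _≟_)
open import Data.Fin.Subset using (Subset; _∈_; ∣_∣)
open import Data.List using (List; []; _∷_; map; allFin; length)
open import Data.Nat.ListAction using (sum)
open import Data.List.Relation.Unary.All using (All)
open import Data.Vec using (tabulate)
open import Data.Product using (Σ; ∃; _×_; _,_)
open import Data.Sum using (_⊎_)
open import Relation.Nullary using (¬_)
open import Relation.Nullary.Decidable using (isYes)
open import Relation.Binary.PropositionalEquality using (_≡_)

record SimpleGraph (n : ℕ) : Set where
  field
    adj   : Fin n → Fin n → Bool
    sym   : ∀ u v → adj u v ≡ adj v u
    irrfl : ∀ v → adj v v ≡ false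
open SimpleGraph public

IsStableSet : ∀ {n} → SimpleGraph n → Subset n → Set
IsStableSet G S = ∀ u v → u ∈ S → v ∈ S → adj G u v ≡ false

IsIndependenceNumber : ∀ {n} → SimpleGraph n → ℕ → Set
IsIndependenceNumber G a =
  (Σ _ λ S → IsStableSet G S × ∣ S ∣ ≡ a) × (∀ S → IsStableSet G S → ∣ S ∣ ≤ a)

-- Stable partitions: a set partition of V(G) into k nonempty stable
-- blocks, given by a surjective block labelling  block : Fin n → Fin k.

record StablePartition {n : ℕ} (G : SimpleGraph n) : Set where
  field
    k      : ℕ
    block  : Fin n → Fin k
    onto   : ∀ i → ∃ λ v → block v ≡ i
    stable : ∀ u v → block u ≡ block v → adj G u v ≡ false
open StablePartition public

blockSet : ∀ {n} {G : SimpleGraph n} (P : StablePartition G) → Fin (k P) → Subset n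
blockSet P i = tabulate (λ v → isYes (block P v ≟ i))

blockSize : ∀ {n} {G : SimpleGraph n} (P : StablePartition G) → Fin (k P) → ℕ
blockSize P i = ∣ blockSet P i ∣

-- the type of P: the (unordered) list of block sizes
partitionType : ∀ {n} {G : SimpleGraph n} → StablePartition G → List ℕ
partitionType P = map (blockSize P) (allFin (k P))

data Decreasing : List ℕ → Set where
  []  : Decreasing []
  [_] : ∀ x → Decreasing (x ∷ [])
  _∷_ : ∀ {x y xs} → x ≥ y → Decreasing (y ∷ xs) → Decreasing (x ∷ y ∷ xs)

IsPartition : List ℕ → Set
IsPartition λ′ = Decreasing λ′ × All (λ x → 1 ≤ x) λ′

-- λ_r (0-indexed rows from the bottom), 0 beyond the last part
part : List ℕ → ℕ → ℕ
part []       _       = 0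
part (x ∷ _)  zero    = x
part (_ ∷ xs) (suc r) = part xs r

-- Young diagrams (French notation): cell (r , c) = row r, column c

Cell : Set
Cell = ℕ × ℕ

InDiagram : List ℕ → Cell → Set
InDiagram λ′ (r , c) = c < part λ′ r

InSkew : List ℕ → List ℕ → Cell → Set
InSkew λ′ μ x = InDiagram λ′ x × ¬ InDiagram μ x

Adjacent : Cell → Cell → Set
Adjacent (r , c) (r′ , c′) =
  (r ≡ r′ × (suc c ≡ c′ ⊎ c ≡ suc c′)) ⊎ (c ≡ c′ × (suc r ≡ r′ ⊎ r ≡ suc r′))

data Path (P : Cell → Set) : Cell → Cell → Set where
  here : ∀ {x} → P x → Path P x x
  step : ∀ {x y z} → P x → Adjacent x y → Path P y z → Path P x z

-- μ is obtained from λ by removing a rim hook: μ is a partition contained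
-- in λ, and the removed cells λ/μ form a nonempty edge-connected set lying
-- along the boundary (containing no 2×2 square).
record RemovesRimHook (λ′ μ : List ℕ) : Set where
  field
    μ-partition : IsPartition μ
    contained   : ∀ r → part μ r ≤ part λ′ r
    nonempty    : ∃ λ x → InSkew λ′ μ x
    connected   : ∀ x y → InSkew λ′ μ x → InSkew λ′ μ y → Path (InSkew λ′ μ) x y
    no-square   : ∀ r c → ¬ (InSkew λ′ μ (r , c) × InSkew λ′ μ (suc r , c)
                              × InSkew λ′ μ (r , suc c) × InSkew λ′ μ (suc r , suc c))

MeetsFirstColumn : List ℕ → List ℕ → Set
MeetsFirstColumn λ′ μ = ∃ λ r → InSkew λ′ μ (r , 0)

-- Special rim hook tabloids of shape λ, presented as a sequence of
-- successive rim hook removals λ = μ₀ ⊃ μ₁ ⊃ ... ⊃ μ_m = ∅, each removed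
-- rim hook meeting the first column.  SpecialRHT λ hs: hs is the list of
-- lengths (numbers of cells) of the rim hooks, i.e. the parts of π(T).

data SpecialRHT : List ℕ → List ℕ → Set where
  done : SpecialRHT [] []
  rem  : ∀ {λ′ μ hs} → RemovesRimHook λ′ μ → MeetsFirstColumn λ′ μ →
         SpecialRHT μ hs → SpecialRHT λ′ ((sum λ′ Data.Nat.∸ sum μ) ∷ hs)

module Submission where

open import Defs hiding (sym)
open import Data.Nat using (ℕ; _≤_; _<_; zero; suc; s≤s; z≤n)
open import Data.Nat.Properties using (≤-trans; <-≤-trans)
open import Data.Fin using (_≟_)
import Data.Fin.Subset as Subset
open import Data.List using (List; length; []; _∷_)
open import Data.Nat.ListAction using (sum)
open import Data.List.Relation.Unary.All using (All; []; _∷_)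
open import Data.List.Relation.Unary.All.Properties using (map⁺; tabulate⁺)
open import Data.List.Membership.Propositional using (_∈_)
open import Data.List.Membership.Propositional.Properties using (∈-map⁺; ∈-allFin)
open import Data.List.Relation.Binary.Permutation.Propositional using (_↭_)
open import Data.List.Relation.Binary.Permutation.Propositional.Properties
  using (All-resp-↭; ∈-resp-↭)
open import Data.Product using (Σ; ∃; _×_; _,_; proj₂)
open import Data.Vec.Properties using ([]=⇒lookup; lookup∘tabulate)
open import Data.Bool using (true)
open import Data.Bool.Properties using (T-≡)
open import Function using (Equivalence)
open import Relation.Nullary using (¬_; contradiction)
open import Relation.Nullary.Decidable using (isYes; toWitness)
open import Relation.Binary.PropositionalEquality using (_≡_; trans; sym; subst)

module _ {n} {G : SimpleGraph n} (P : StablePartition G) where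

  ∈-blockSet⇒block≡ : ∀ {i v} → v Subset.∈ blockSet P i → block P v ≡ i
  ∈-blockSet⇒block≡ {i} {v} v∈ = toWitness (Equivalence.from T-≡ isYes≡true)
    where
    isYes≡true : isYes (block P v ≟ i) ≡ true
    isYes≡true = trans (sym (lookup∘tabulate (λ w → isYes (block P w ≟ i)) v)) ([]=⇒lookup v∈)

  blockSet-stable : ∀ i → IsStableSet G (blockSet P i)
  blockSet-stable i u v u∈ v∈ =
    stable P u v (trans (∈-blockSet⇒block≡ u∈) (sym (∈-blockSet⇒block≡ v∈)))

  partitionType-bounded : ∀ {a} → (∀ S → IsStableSet G S → Subset.∣ S ∣ ≤ a) →
                          All (_≤ a) (partitionType P)
  partitionType-bounded bound =
    map⁺ (tabulate⁺ λ i → bound (blockSet P i) (blockSet-stable i))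

  blockSize∈partitionType : ∀ i → blockSize P i ∈ partitionType P
  blockSize∈partitionType i = ∈-map⁺ (blockSize P) (∈-allFin i)

part-positive⇒<length : ∀ (l : List ℕ) r → 0 < part l r → r < length l
part-positive⇒<length (_ ∷ _) zero    _ = s≤s z≤n
part-positive⇒<length (_ ∷ l) (suc r) p = s≤s (part-positive⇒<length l r p)

¬part-positive⇒length≤ : ∀ (l : List ℕ) r → All (1 ≤_) l → ¬ (0 < part l r) → length l ≤ r
¬part-positive⇒length≤ []      _       _        _  = z≤n
¬part-positive⇒length≤ (_ ∷ _) zero    (p ∷ _)  np = contradiction p np
¬part-positive⇒length≤ (_ ∷ l) (suc r) (_ ∷ ps) np = s≤s (¬part-positive⇒length≤ l r ps np)

-- A hook through the first column empties some row r of λ, so μ has at most r rows.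
meetsFirstColumn⇒length< : ∀ {λ′ μ} → All (1 ≤_) μ → MeetsFirstColumn λ′ μ →
                           length μ < length λ′
meetsFirstColumn⇒length< {λ′} {μ} μ-positive (r , in-λ , not-in-μ) =
  <-≤-trans (s≤s (¬part-positive⇒length≤ μ r μ-positive not-in-μ))
            (part-positive⇒<length λ′ r in-λ)

SpecialRHT-length≤ : ∀ {λ′ hs} → SpecialRHT λ′ hs → length hs ≤ length λ′
SpecialRHT-length≤ done = z≤n
SpecialRHT-length≤ {λ′} (rem {μ = μ} R first T) =
  ≤-trans (s≤s (SpecialRHT-length≤ T))
          (meetsFirstColumn⇒length< {λ′} {μ} (proj₂ (RemovesRimHook.μ-partition R)) first)

lemma3p2 : ∀ {n} (G : SimpleGraph n) (λ′ : List ℕ) → IsPartition λ′ → sum λ′ ≡ n →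
    ∀ (hs : List ℕ) → SpecialRHT λ′ hs →
    (Σ (StablePartition G) λ P → partitionType P ↭ hs) →
    ((∀ a → IsIndependenceNumber G a → All (λ h → h ≤ a) hs)
    × length hs ≤ length λ′
    × ((∀ (P : StablePartition G) → ∃ λ i → blockSize P i ≡ 1) → 1 ∈ hs))
lemma3p2 G λ′ _ _ hs T (P , type↭hs) =
  (λ a (_ , maximal) → All-resp-↭ type↭hs (partitionType-bounded P maximal)) ,
  SpecialRHT-length≤ T ,
  singletonBlock⇒1∈hs
  where
  singletonBlock⇒1∈hs : (∀ (Q : StablePartition G) → ∃ λ i → blockSize Q i ≡ 1) → 1 ∈ hs
  singletonBlock⇒1∈hs singleton with i , size≡1 ← singleton P =
    ∈-resp-↭ type↭hs (subst (_∈ partitionType P) size≡1 (blockSize∈partitionType P i))
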